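{- No proper BE algebra, proper aBE algebra, proper BE** algebra or proper aBE** algebra satisfies (pimpl).
   Context: Algebras are $(A,\to,1)$ of type $(2,0)$. Properties, for all $x,y,z\in A$: (Re) $x\to x=1$; (M) $1\to x=x$; (L) $x\to1=1$; (Ex) $x\to(y\to z)=y\to(x\to z)$; (An) $x\to y=1=y\to x\Rightarrow x=y$; (B) $(y\to z)\to[(x\to y)\to(x\to z)]=1$; (BB) $(y\to z)\to[(z\to x)\to(y\to x)]=1$; (*) $y\to z=1\Rightarrow (x\to y)\to(x\to z)=1$; (**) $y\to z=1\Rightarrow(z\to x)\to(y\to x)=1$; (Tr) $x\to y=1=y\to z\Rightarrow x\to z=1$; (pi) $y\to(y\to x)=y\to x$; (pimpl) $x\to(y\to z)=(x\to y)\to(x\to z)$. A proper BE algebra satisfies (Re), (M), (L), (Ex) and does not satisfy any of (An), (Tr), (*), (B), (**), (BB), (pi). A proper aBE algebra satisfies (Re), (M), (L), (Ex), (An) and does not satisfy any of (B), (BB), (*), (**), (Tr), (pi). A proper BE** algebra satisfies (Re), (M), (L), (Ex), (**) and does not satisfy any of (An), (BB), (*), (B), (pi). A proper aBE** algebra satisfies (Re), (M), (L), (Ex), (An), (**) and does not satisfy any of (BB), (*), (B), (pi). -}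

module Defs where

open import Level using (Level)
open import Data.Product using (_×_)
open import Relation.Nullary using (¬_)
open import Relation.Binary.PropositionalEquality using (_≡_)

-- An algebra (A, →, 1) of type (2,0) is given by a carrier A, a binary
-- operation _⇒_ (the paper's →) and a constant 𝟙 (the paper's 1).
module _ {a : Level} {A : Set a} (_⇒_ : A → A → A) (𝟙 : A) where

  Re : Set a
  Re = ∀ x → x ⇒ x ≡ 𝟙

  M : Set a
  M = ∀ x → 𝟙 ⇒ x ≡ x

  L : Set a
  L = ∀ x → x ⇒ 𝟙 ≡ 𝟙

  Ex : Set a
  Ex = ∀ x y z → x ⇒ (y ⇒ z) ≡ y ⇒ (x ⇒ z)

  An : Set a
  An = ∀ x y → x ⇒ y ≡ 𝟙 → y ⇒ x ≡ 𝟙 → x ≡ y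

  B : Set a
  B = ∀ x y z → (y ⇒ z) ⇒ ((x ⇒ y) ⇒ (x ⇒ z)) ≡ 𝟙

  BB : Set a
  BB = ∀ x y z → (y ⇒ z) ⇒ ((z ⇒ x) ⇒ (y ⇒ x)) ≡ 𝟙

  Star : Set a
  Star = ∀ x y z → y ⇒ z ≡ 𝟙 → (x ⇒ y) ⇒ (x ⇒ z) ≡ 𝟙

  StarStar : Set a
  StarStar = ∀ x y z → y ⇒ z ≡ 𝟙 → (z ⇒ x) ⇒ (y ⇒ x) ≡ 𝟙

  Tr : Set a
  Tr = ∀ x y z → x ⇒ y ≡ 𝟙 → y ⇒ z ≡ 𝟙 → x ⇒ z ≡ 𝟙

  Pi : Set a
  Pi = ∀ x y → y ⇒ (y ⇒ x) ≡ y ⇒ x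

  Pimpl : Set a
  Pimpl = ∀ x y z → x ⇒ (y ⇒ z) ≡ (x ⇒ y) ⇒ (x ⇒ z)

  BEAxioms : Set a
  BEAxioms = Re × M × L × Ex

  ProperBE : Set a
  ProperBE = BEAxioms
    × ¬ An × ¬ Tr × ¬ Star × ¬ B × ¬ StarStar × ¬ BB × ¬ Pi

  ProperaBE : Set a
  ProperaBE = BEAxioms × An
    × ¬ B × ¬ BB × ¬ Star × ¬ StarStar × ¬ Tr × ¬ Pi

  ProperBE** : Set a
  ProperBE** = BEAxioms × StarStar
    × ¬ An × ¬ BB × ¬ Star × ¬ B × ¬ Pi

  ProperaBE** : Set a
  ProperaBE** = BEAxioms × An × StarStar
    × ¬ BB × ¬ Star × ¬ B × ¬ Pi

-- In presence of (Re) and (M), (pimpl) with x := y gives y → (y → x) = (y → y) → (y → x) = y → x,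
-- i.e. (pi); and none of the four proper classes satisfies (pi).

module Submission where

open import Defs
open import Level using (Level)
open import Data.Sum using (_⊎_; [_,_])
open import Data.Product using (_×_; _,_)
open import Relation.Nullary using (¬_)
open import Relation.Binary.PropositionalEquality using (_≡_; cong; module ≡-Reasoning)

module _ {a : Level} {A : Set a} (_⇒_ : A → A → A) (𝟙 : A) where

  pimpl⇒pi : Re _⇒_ 𝟙 → M _⇒_ 𝟙 → Pimpl _⇒_ 𝟙 → Pi _⇒_ 𝟙
  pimpl⇒pi re m pimpl x y = begin
    y ⇒ (y ⇒ x)          ≡⟨ pimpl y y x ⟩
    (y ⇒ y) ⇒ (y ⇒ x)    ≡⟨ cong (_⇒ (y ⇒ x)) (re y) ⟩
    𝟙 ⇒ (y ⇒ x)          ≡⟨ m (y ⇒ x) ⟩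
    y ⇒ x                ∎
    where open ≡-Reasoning

  ¬pi⇒¬pimpl : Re _⇒_ 𝟙 × M _⇒_ 𝟙 × ¬ Pi _⇒_ 𝟙 → ¬ Pimpl _⇒_ 𝟙
  ¬pi⇒¬pimpl (re , m , ¬pi) pimpl = ¬pi (pimpl⇒pi re m pimpl)

  properBE⇒¬pi : ProperBE _⇒_ 𝟙 → Re _⇒_ 𝟙 × M _⇒_ 𝟙 × ¬ Pi _⇒_ 𝟙
  properBE⇒¬pi ((re , m , _) , _ , _ , _ , _ , _ , _ , ¬pi) = re , m , ¬pi

  properaBE⇒¬pi : ProperaBE _⇒_ 𝟙 → Re _⇒_ 𝟙 × M _⇒_ 𝟙 × ¬ Pi _⇒_ 𝟙
  properaBE⇒¬pi ((re , m , _) , _ , _ , _ , _ , _ , _ , ¬pi) = re , m , ¬pi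

  properBE**⇒¬pi : ProperBE** _⇒_ 𝟙 → Re _⇒_ 𝟙 × M _⇒_ 𝟙 × ¬ Pi _⇒_ 𝟙
  properBE**⇒¬pi ((re , m , _) , _ , _ , _ , _ , _ , ¬pi) = re , m , ¬pi

  properaBE**⇒¬pi : ProperaBE** _⇒_ 𝟙 → Re _⇒_ 𝟙 × M _⇒_ 𝟙 × ¬ Pi _⇒_ 𝟙
  properaBE**⇒¬pi ((re , m , _) , _ , _ , _ , _ , _ , ¬pi) = re , m , ¬pi

corollary6p6 : {a : Level} (A : Set a) (_⇒_ : A → A → A) (𝟙 : A)
    → ProperBE _⇒_ 𝟙 ⊎ ProperaBE _⇒_ 𝟙 ⊎ ProperBE** _⇒_ 𝟙 ⊎ ProperaBE** _⇒_ 𝟙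
    → ¬ Pimpl _⇒_ 𝟙
corollary6p6 A _⇒_ 𝟙 proper = ¬pi⇒¬pimpl _⇒_ 𝟙 (reM¬pi proper)
  where
  reM¬pi : ProperBE _⇒_ 𝟙 ⊎ ProperaBE _⇒_ 𝟙 ⊎ ProperBE** _⇒_ 𝟙 ⊎ ProperaBE** _⇒_ 𝟙
         → Re _⇒_ 𝟙 × M _⇒_ 𝟙 × ¬ Pi _⇒_ 𝟙
  reM¬pi = [ properBE⇒¬pi _⇒_ 𝟙
           , [ properaBE⇒¬pi _⇒_ 𝟙 , [ properBE**⇒¬pi _⇒_ 𝟙 , properaBE**⇒¬pi _⇒_ 𝟙 ] ] ]
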